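{- Let $n\ge2$, $\lambda=(\lambda_1\ge\dots\ge\lambda_n=0)$ a partition, $\mu=\lambda+(n-1,\dots,1,0)$, and let $T$ be a semistandard Young tableau of shape $\mu$ with entries in $[n]$, with root filling $\widehat{T}=\widehat{C}_1\cdots\widehat{C}_m$ ($m=\mu_1$). Then $n(T)>0$ if and only if $\widehat{T}$ is not disjoint, i.e. if and only if some pair $(\widehat{C}_{i-1},\widehat{C}_i)$, $2\le i\le m$, fails the Non-overlapping Condition.
   Context: Separating walls: $T$ has rows $1,\dots,n-1$. In row $r$, for each $k$ with $r\le k\le n$, there is a wall $|_k$ at position $P_r(k)$ = number of entries of row $r$ that are $\le k$ (i.e. placed after the last box with entry $\le k$ and before the first box with entry $>k$; position $0$ is the start of the row). Additionally there is an extra row $n$ containing the single wall $|_{n}$ at position $0$. A wall is directly above another if it lies in the row immediately above it at the same position. $n(T)$ is the number of pairs of walls $|_{k-1}|_k$ in a row $r$ with no entry between them ($P_r(k-1)=P_r(k)$) which are directly above a pair $|_k|_{k+1}$ in row $r+1$ with no entry between them ($P_{r+1}(k)=P_{r+1}(k+1)=P_r(k)$). Root: $\widehat{C}_m$ is the last column of $T$; for $i=m-1,\dots,1$, $\widehat{C}_i$ is the hat column built from the set $S_i$ of entries of column $i$ of $T$ and the column $C'=\widehat{C}_{i+1}$: process elements of $S_i$ in decreasing order; an element occurring in $C'$ goes in its row of $C'$; an element not in $C'$ goes, if $|S_i|=|C'|+1$ and row $|C'|+1$ is still empty, in that row, else in the row of the largest entry of $C'$ whose row in the left column is still empty. Non-overlapping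 Condition for a pair $(C,C')$ with $|C|\in\{|C'|,|C'|+1\}$: row $q$ is a pivot if $q\le|C'|$ and $C(q)<C'(q)$, or $q=|C'|+1\le|C|$; set $b_q=C(q)$, $d_q=C'(q)$ (or $\infty$ for $q=|C'|+1$); the condition holds if there is at most one pivot or the intervals $[b_q,d_q]$ for distinct pivots are pairwise disjoint. -}

module Defs where

open import Data.Bool using (Bool; true; false; _∧_; if_then_else_)
open import Data.Nat using (ℕ; zero; suc; _+_; _∸_; _≤_; _<_; _≤ᵇ_; _<ᵇ_; _≡ᵇ_; _≟_; _≤?_)
open import Data.List using (List; []; _∷_; length; map; filter; zipWith; downFrom; last;
  reverse; replicate; foldl; concatMap; mapMaybe; upTo)
open import Data.Nat.ListAction using (sum)
open import Data.List.Relation.Unary.Linked using (Linked)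
open import Data.List.Relation.Unary.AllPairs using (AllPairs)
open import Data.Maybe using (Maybe; just; nothing; fromMaybe)
import Data.Maybe as Maybe
open import Data.Product using (_×_; _,_; proj₁; proj₂; ∃-syntax)
open import Data.Sum using (_⊎_)
open import Data.Empty using (⊥)
open import Relation.Nullary using (¬_; yes; no)
open import Relation.Binary.PropositionalEquality using (_≡_)
open import Data.Nat using (_≥_)

nth : {A : Set} → ℕ → List A → Maybe A
nth _       []       = nothing
nth zero    (x ∷ _)  = just x
nth (suc i) (_ ∷ xs) = nth i xs

setAt : {A : Set} → ℕ → A → List A → List A
setAt _       _ []       = []
setAt zero    a (_ ∷ xs) = a ∷ xs
setAt (suc i) a (x ∷ xs) = x ∷ setAt i a xs

oneTo : ℕ → List ℕ
oneTo n = map suc (upTo n)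

IsPartition : ℕ → List ℕ → Set
IsPartition n lam = (length lam ≡ n) × Linked _≥_ lam × (last lam ≡ just 0)

mu : ℕ → List ℕ → List ℕ
mu n lam = zipWith _+_ lam (downFrom n)

-- Tableaux: a list of rows (row 1 first), each row a list of entries
-- (left to right).  Rows are 1-based in the functions below.

Tableau : Set
Tableau = List (List ℕ)

-- entry in 0-based row r, 0-based column c
entry : Tableau → ℕ → ℕ → Maybe ℕ
entry T r c = Maybe._>>=_ (nth r T) (nth c)

record IsSSYT (n : ℕ) (sh : List ℕ) (T : Tableau) : Set where
  field
    shape      : map length T ≡ sh
    entries    : ∀ r c x → entry T r c ≡ just x → (1 ≤ x) × (x ≤ n)
    rowsWeak   : ∀ r c x y → entry T r c ≡ just x → entry T r (suc c) ≡ just y → x ≤ y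
    colsStrict : ∀ r c x y → entry T r c ≡ just x → entry T (suc r) c ≡ just y → x < y

-- row r (1-based); rows outside T are empty
rowOf : Tableau → ℕ → List ℕ
rowOf T r = fromMaybe [] (nth (r ∸ 1) T)

P : Tableau → ℕ → ℕ → ℕ
P T r k = length (filter (_≤? k) (rowOf T r))

-- wall |_k exists in row r: rows 1..n-1 carry walls k = r..n, and the extra
-- row n carries only |_n (at position 0 = P_n(n), row n of T being empty).
-- Both cases are exactly 1 ≤ r ≤ k ≤ n.
wall : ℕ → ℕ → ℕ → Bool
wall n r k = (1 ≤ᵇ r) ∧ ((r ≤ᵇ k) ∧ (k ≤ᵇ n))

-- pair |_j |_{j+1} in row r with no entry between them, directly above the
-- pair |_{j+1} |_{j+2} in row r+1 with no entry between them
countedPair : ℕ → Tableau → ℕ → ℕ → Bool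
countedPair n T r j =
  wall n r j ∧ (wall n r (suc j) ∧ (wall n (suc r) (suc j) ∧ (wall n (suc r) (suc (suc j)) ∧
  ((P T r j ≡ᵇ P T r (suc j)) ∧ ((P T (suc r) (suc j) ≡ᵇ P T r j) ∧
   (P T (suc r) (suc (suc j)) ≡ᵇ P T r j))))))

nT : ℕ → Tableau → ℕ
nT n T = sum (concatMap (λ r → map (λ j → if countedPair n T r j then 1 else 0) (oneTo n)) (oneTo n))

width : Tableau → ℕ
width T = length (rowOf T 1)

colOf : Tableau → ℕ → List ℕ
colOf T i = mapMaybe (nth (i ∸ 1)) T

columns : Tableau → List (List ℕ)
columns T = map (colOf T) (oneTo (width T))

indexOf : ℕ → List ℕ → Maybe ℕ
indexOf x [] = nothing
indexOf x (y ∷ ys) with x ≟ y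
... | yes _ = just 0
... | no  _ = Maybe.map suc (indexOf x ys)

candidates : ℕ → List ℕ → List (Maybe ℕ) → List (ℕ × ℕ)
candidates j (c ∷ cs) (nothing ∷ ns) = (j , c) ∷ candidates (suc j) cs ns
candidates j (c ∷ cs) (just _ ∷ ns)  = candidates (suc j) cs ns
candidates _ _ _ = []

best : List (ℕ × ℕ) → Maybe (ℕ × ℕ)
best [] = nothing
best (p ∷ ps) with best ps
... | nothing = just p
... | just q  = if proj₂ q ≤ᵇ proj₂ p then just p else just q

isEmptyRow : ℕ → List (Maybe ℕ) → Bool
isEmptyRow j new with nth j new
... | just nothing = true
... | _            = false

place : List ℕ → ℕ → List (Maybe ℕ) → ℕ → List (Maybe ℕ)
place C' L new x with indexOf x C'
... | just j  = setAt j (just x) new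
... | nothing =
  if (L ≡ᵇ suc (length C')) ∧ isEmptyRow (length C') new
  then setAt (length C') (just x) new
  else placeBest (best (candidates 0 C' new))
  where
    placeBest : Maybe (ℕ × ℕ) → List (Maybe ℕ)
    placeBest nothing        = new
    placeBest (just (j , _)) = setAt j (just x) new

-- hat column built from the set S (given as the column of T, increasing
-- top to bottom, so `reverse S` lists it in decreasing order) and C'
hatCol : List ℕ → List ℕ → List ℕ
hatCol S C' = map (fromMaybe 0) (foldl (place C' (length S)) (replicate (length S) nothing) (reverse S))

rootStep : List ℕ → List (List ℕ) → List (List ℕ)
rootStep c [] = c ∷ []
rootStep c (c' ∷ rest) = hatCol c c' ∷ c' ∷ rest

rootCols : List (List ℕ) → List (List ℕ)
rootCols [] = []
rootCols (c ∷ cs) = rootStep c (rootCols cs)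

rootFilling : Tableau → List (List ℕ)
rootFilling T = rootCols (columns T)

hatC : Tableau → ℕ → List ℕ
hatC T i = fromMaybe [] (nth (i ∸ 1) (rootFilling T))

-- pivot intervals [b_q, d_q]; nothing = ∞
pivots : List ℕ → List ℕ → List (ℕ × Maybe ℕ)
pivots [] _ = []
pivots (c ∷ _) [] = (c , nothing) ∷ []
pivots (c ∷ cs) (d ∷ ds) = if c <ᵇ d then (c , just d) ∷ pivots cs ds else pivots cs ds

IntervalsDisjoint : ℕ × Maybe ℕ → ℕ × Maybe ℕ → Set
IntervalsDisjoint (b , just d)  (b' , just d') = (d < b') ⊎ (d' < b)
IntervalsDisjoint (b , just d)  (b' , nothing) = d < b'
IntervalsDisjoint (b , nothing) (b' , just d') = d' < b
IntervalsDisjoint (b , nothing) (b' , nothing) = ⊥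

NonOverlapping : List ℕ → List ℕ → Set
NonOverlapping C C' = (length (pivots C C') ≤ 1) ⊎ AllPairs IntervalsDisjoint (pivots C C')

RootNotDisjoint : Tableau → Set
RootNotDisjoint T = ∃[ i ] ((2 ≤ i) × (i ≤ width T) × ¬ NonOverlapping (hatC T (i ∸ 1)) (hatC T i))

-- A counted pair of walls in rows r, r + 1 exists exactly when some entry y of row r + 1 is
-- smaller than the entry z of row r one column to the right: then |_{y-1} |_y in row r and
-- |_y |_{y+1} in row r + 1 all sit right after that column, and conversely equal wall positions
-- locate such a pair of entries.  So n(T) > 0 iff two adjacent columns S, S′ of T have a
-- descent S(q + 1) < S′(q).
--
-- The hat column C built from S over C′ (a rearrangement of S′) is a rearrangement of S that
-- agrees with C′ on common entries and lies strictly below C′ elsewhere; that rows never run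
-- out is a Hall-type count using S ≤ S′ rowwise.  Hence the pivots are the rows where C ≠ C′,
-- and counting entries ≤ v row by row gives
--   #{S ≤ v} = #{S′ ≤ v} + #{pivot intervals [b, d) containing v}.
-- Pivot intervals overlap iff some v is covered twice, iff S(q + 1) ≤ v < S′(q) for
-- q = #{S′ ≤ v}, i.e. iff S, S′ have a descent.

module Submission where

open import Defs
open import Data.Bool using (true; false; _∧_; if_then_else_)
import Data.Bool as Bool
open import Data.Bool.Properties using (T-∧; T-≡)
open import Data.Empty using (⊥; ⊥-elim)
open import Data.Unit using (⊤; tt)
open import Function using (_∘_; id)
open import Data.List using (List; []; _∷_; [_]; _++_; length; map; filter; reverse; replicate; foldl; drop;
  catMaybes; downFrom; upTo; applyUpTo; mapMaybe)
open import Data.List.Properties using (length-++; ++-assoc; unfold-reverse; foldl-++; length-replicate; length-map;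
  length-zipWith; length-downFrom; length-filter; length-catMaybes; filter-all; filter-none; filter-some; filter-accept; filter-reject)
open import Data.List.Membership.Propositional using (_∈_; _∉_; lose)
open import Data.List.Membership.Propositional.Properties using (∈-++⁺ˡ; ∈-++⁺ʳ; ∈-map⁺; ∈-map⁻; ∈-upTo⁺;
  ∈-concatMap⁺; ∈-concatMap⁻)
open import Data.List.Relation.Unary.All as All using (All; []; _∷_)
open import Data.List.Relation.Unary.AllPairs as AllPairs using (AllPairs; []; _∷_)
open import Data.List.Relation.Unary.Any using (here; there; satisfied)
open import Data.List.Relation.Unary.Linked using (Linked; []; [-]; _∷_)
import Data.List.Relation.Unary.Linked as Linked
import Data.List.Relation.Unary.Linked.Properties as Linked
open import Data.List.Relation.Unary.Linked.Properties using (Linked⇒AllPairs)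
open import Data.List.Relation.Unary.Unique.Propositional using (Unique)
open import Data.List.Relation.Binary.Pointwise using (Pointwise; []; _∷_)
open import Data.List.Relation.Binary.Permutation.Propositional
  using (_↭_; ↭-refl; ↭-reflexive; ↭-sym; ↭-trans; ↭-prep; ↭-swap; ↭⇒↭ₛ)
open import Data.List.Relation.Binary.Permutation.Propositional.Properties using (↭-length; ∈-resp-↭; filter-↭)
import Data.List.Relation.Binary.Permutation.Setoid.Properties as ↭ₛ
open import Data.Maybe using (Maybe; just; nothing; fromMaybe)
open import Data.Maybe.Properties using (just-injective)
import Data.Maybe as Maybe
open import Data.Nat
  using (ℕ; zero; suc; _+_; _∸_; _⊓_; _≤_; _<_; _≥_; _>_; _≤ᵇ_; _<ᵇ_; _≡ᵇ_; _≟_; _≤?_; _<?_; z≤n; s≤s)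
open import Data.List.Membership.DecPropositional _≟_ using (_∈?_)
open import Data.Nat.Properties
open import Data.Nat.ListAction using (sum)
open import Data.Product using (∃-syntax; _×_; _,_; proj₁; proj₂)
open import Data.Sum using (_⊎_; inj₁; inj₂; [_,_]′)
import Data.Sum
open import Function.Bundles using (_⇔_; mk⇔; Equivalence)
import Function.Properties.Equivalence as ⇔
open import Relation.Nullary using (¬_; Dec; yes; no)
open import Relation.Nullary.Decidable using (_×-dec_; _⊎-dec_)
open import Relation.Binary.PropositionalEquality using (_≡_; _≢_; refl; sym; trans; cong; subst; subst₂; setoid; module ≡-Reasoning)

nth-just⇒∈ : ∀ {A : Set} k (xs : List A) {y} → nth k xs ≡ just y → y ∈ xs
nth-just⇒∈ zero    (x ∷ xs) refl = here refl
nth-just⇒∈ (suc k) (x ∷ xs) e    = there (nth-just⇒∈ k xs e)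

nth-just⇒< : ∀ {A : Set} k (xs : List A) {y} → nth k xs ≡ just y → k < length xs
nth-just⇒< zero    (x ∷ xs) _ = s≤s z≤n
nth-just⇒< (suc k) (x ∷ xs) e = s≤s (nth-just⇒< k xs e)

<⇒nth-just : ∀ {A : Set} k (xs : List A) → k < length xs → ∃[ y ] nth k xs ≡ just y
<⇒nth-just zero    (x ∷ xs) _       = x , refl
<⇒nth-just (suc k) (x ∷ xs) (s≤s p) = <⇒nth-just k xs p

≤⇒nth-nothing : ∀ {A : Set} k (xs : List A) → length xs ≤ k → nth k xs ≡ nothing
≤⇒nth-nothing k       []       _       = refl
≤⇒nth-nothing (suc k) (x ∷ xs) (s≤s p) = ≤⇒nth-nothing k xs p

nth-nothing⇒≤ : ∀ {A : Set} k (xs : List A) → nth k xs ≡ nothing → length xs ≤ k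
nth-nothing⇒≤ k       []       _ = z≤n
nth-nothing⇒≤ (suc k) (x ∷ xs) e = s≤s (nth-nothing⇒≤ k xs e)

nth-functional : ∀ {A : Set} k (xs : List A) {a b} → nth k xs ≡ just a → nth k xs ≡ just b → a ≡ b
nth-functional k xs e e′ = just-injective (trans (sym e) e′)

nth-injective : ∀ {xs : List ℕ} → Unique xs → ∀ k k′ {c} → nth k xs ≡ just c → nth k′ xs ≡ just c → k ≡ k′
nth-injective {x ∷ xs} (_ ∷ _)  zero    zero     _    _    = refl
nth-injective {x ∷ xs} (x∉ ∷ _) zero    (suc k′) refl e′   = ⊥-elim (All.lookup x∉ (nth-just⇒∈ k′ xs e′) refl)
nth-injective {x ∷ xs} (x∉ ∷ _) (suc k) zero     e    refl = ⊥-elim (All.lookup x∉ (nth-just⇒∈ k xs e) refl)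
nth-injective {x ∷ xs} (_ ∷ u)  (suc k) (suc k′) e    e′   = cong suc (nth-injective u k k′ e e′)

nth-map : ∀ {A B : Set} (f : A → B) k xs → nth k (map f xs) ≡ Maybe.map f (nth k xs)
nth-map f k       []       = refl
nth-map f zero    (x ∷ xs) = refl
nth-map f (suc k) (x ∷ xs) = nth-map f k xs

nth-++-length : ∀ {A : Set} (xs : List A) {y ys} → nth (length xs) (xs ++ y ∷ ys) ≡ just y
nth-++-length []       = refl
nth-++-length (x ∷ xs) = nth-++-length xs

nth-replicate : ∀ {A : Set} (a : A) L k → k < L → nth k (replicate L a) ≡ just a
nth-replicate a (suc L) zero    _       = refl
nth-replicate a (suc L) (suc k) (s≤s p) = nth-replicate a L k p

length-setAt : ∀ {A : Set} j (a : A) xs → length (setAt j a xs) ≡ length xs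
length-setAt j       a []       = refl
length-setAt zero    a (x ∷ xs) = refl
length-setAt (suc j) a (x ∷ xs) = cong suc (length-setAt j a xs)

nth-setAt-≡ : ∀ {A : Set} j (a : A) xs → j < length xs → nth j (setAt j a xs) ≡ just a
nth-setAt-≡ zero    a (x ∷ xs) _       = refl
nth-setAt-≡ (suc j) a (x ∷ xs) (s≤s p) = nth-setAt-≡ j a xs p

nth-setAt-≢ : ∀ {A : Set} k j (a : A) xs → k ≢ j → nth k (setAt j a xs) ≡ nth k xs
nth-setAt-≢ k       j       a []       _  = refl
nth-setAt-≢ zero    zero    a (x ∷ xs) ne = ⊥-elim (ne refl)
nth-setAt-≢ zero    (suc j) a (x ∷ xs) _  = refl
nth-setAt-≢ (suc k) zero    a (x ∷ xs) _  = refl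
nth-setAt-≢ (suc k) (suc j) a (x ∷ xs) ne = nth-setAt-≢ k j a xs (ne ∘ cong suc)

nth-map-just⁻ : ∀ {A B : Set} (f : A → B) k xs {y} → nth k (map f xs) ≡ just y → ∃[ x ] (nth k xs ≡ just x × f x ≡ y)
nth-map-just⁻ f k xs e rewrite nth-map f k xs with nth k xs | e
... | just x | refl = x , refl , refl

nth-applyUpTo : ∀ (f : ℕ → ℕ) m k → k < m → nth k (applyUpTo f m) ≡ just (f k)
nth-applyUpTo f (suc m) zero    _       = refl
nth-applyUpTo f (suc m) (suc k) (s≤s p) = nth-applyUpTo (f ∘ suc) m k p

nth-applyUpTo⁻ : ∀ (f : ℕ → ℕ) m k {y} → nth k (applyUpTo f m) ≡ just y → y ≡ f k
nth-applyUpTo⁻ f (suc m) zero    refl = refl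
nth-applyUpTo⁻ f (suc m) (suc k) e    = nth-applyUpTo⁻ (f ∘ suc) m k e

nth⇒linked : ∀ {A : Set} {R : A → A → Set} xs →
             (∀ k {x y} → nth k xs ≡ just x → nth (suc k) xs ≡ just y → R x y) → Linked R xs
nth⇒linked []           _ = []
nth⇒linked (x ∷ [])     _ = [-]
nth⇒linked (x ∷ y ∷ xs) R = R 0 refl refl ∷ nth⇒linked (y ∷ xs) (R ∘ suc)

linked-nth : ∀ {A : Set} {R : A → A → Set} {xs} → Linked R xs →
             ∀ k {x y} → nth k xs ≡ just x → nth (suc k) xs ≡ just y → R x y
linked-nth (Rxy ∷ _)   zero    refl refl = Rxy
linked-nth (_ ∷ rest)  (suc k) e    e′   = linked-nth rest k e e′

pointwise-nth : ∀ {A B : Set} {R : A → B → Set} {xs ys} → Pointwise R xs ys →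
                ∀ k {y} → nth k ys ≡ just y → ∃[ x ] (nth k xs ≡ just x × R x y)
pointwise-nth (Rxy ∷ _)   zero    refl = _ , refl , Rxy
pointwise-nth (_ ∷ rest)  (suc k) e    = pointwise-nth rest k e

length-from-nth : ∀ (S S′ : List ℕ) → (∀ q → nth q S′ ≡ nothing → nth (suc q) S ≡ nothing) →
                  (∀ q → nth q S ≡ nothing → nth q S′ ≡ nothing) → length S ≡ length S′ ⊎ length S ≡ suc (length S′)
length-from-nth S S′ short long with m≤n⇒m<n∨m≡n (nth-nothing⇒≤ _ S (short _ (≤⇒nth-nothing _ S′ ≤-refl)))
... | inj₂ e = inj₂ e
... | inj₁ S<1+S′ = inj₁ (≤-antisym (≤-pred S<1+S′) (nth-nothing⇒≤ _ S′ (long _ (≤⇒nth-nothing _ S ≤-refl))))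

≡⊎≡suc⇒≤ : ∀ {l L} → L ≡ l ⊎ L ≡ suc l → l ≤ L
≡⊎≡suc⇒≤ (inj₁ refl) = ≤-refl
≡⊎≡suc⇒≤ (inj₂ refl) = n≤1+n _

allPairs-before : ∀ {R : ℕ → ℕ → Set} (A : List ℕ) {b B} → AllPairs R (A ++ b ∷ B) → All (λ a → R a b) A
allPairs-before []      _          = []
allPairs-before (a ∷ A) (Ra ∷ Rs) = All.lookup Ra (∈-++⁺ʳ A (here refl)) ∷ allPairs-before A Rs

#≤ : ℕ → List ℕ → ℕ
#≤ v xs = length (filter (_≤? v) xs)

#> : ℕ → List ℕ → ℕ
#> v xs = length (filter (v <?_) xs)

#≤-↭ : ∀ v {xs ys} → xs ↭ ys → #≤ v xs ≡ #≤ v ys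
#≤-↭ v p = ↭-length (filter-↭ (_≤? v) p)

#>-↭ : ∀ v {xs ys} → xs ↭ ys → #> v xs ≡ #> v ys
#>-↭ v p = ↭-length (filter-↭ (v <?_) p)

Sorted : List ℕ → Set
Sorted = AllPairs _≤_

module _ {A : Set} {P : A → Set} (P? : ∀ x → Dec (P x)) where

  length-filter-accept : ∀ {x} xs → P x → length (filter P? (x ∷ xs)) ≡ suc (length (filter P? xs))
  length-filter-accept xs px = cong length (filter-accept P? px)

  length-filter-reject : ∀ {x} xs → ¬ P x → length (filter P? (x ∷ xs)) ≡ length (filter P? xs)
  length-filter-reject xs ¬px = cong length (filter-reject P? ¬px)

#≤-lower : ∀ {xs} → Sorted xs → ∀ k {y} v → nth k xs ≡ just y → y ≤ v → k < #≤ v xs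
#≤-lower {x ∷ xs} (x≤ ∷ s) zero    v refl x≤v rewrite length-filter-accept (_≤? v) xs x≤v = s≤s z≤n
#≤-lower {x ∷ xs} (x≤ ∷ s) (suc k) v e    y≤v
  rewrite length-filter-accept (_≤? v) xs (≤-trans (All.lookup x≤ (nth-just⇒∈ k xs e)) y≤v) = s≤s (#≤-lower s k v e y≤v)

#≤-upper : ∀ {xs} → Sorted xs → ∀ k {y} v → nth k xs ≡ just y → v < y → #≤ v xs ≤ k
#≤-upper {x ∷ xs} (x≤ ∷ s) zero v refl v<x =
  ≤-reflexive (cong length (filter-none (_≤? v) (<⇒≱ v<x ∷ All.map (λ x≤z → <⇒≱ (<-≤-trans v<x x≤z)) x≤)))
#≤-upper {x ∷ xs} (x≤ ∷ s) (suc k) v e v<y with x ≤? v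
... | yes x≤v rewrite length-filter-accept (_≤? v) xs x≤v = s≤s (#≤-upper s k v e v<y)
... | no x≰v  rewrite length-filter-reject (_≤? v) xs x≰v = m≤n⇒m≤1+n (#≤-upper s k v e v<y)

<#≤⇒nth-≤ : ∀ {xs} → Sorted xs → ∀ k v → k < #≤ v xs → ∃[ y ] (nth k xs ≡ just y × y ≤ v)
<#≤⇒nth-≤ {xs} s k v k<# with <⇒nth-just k xs (<-≤-trans k<# (length-filter (_≤? v) xs))
... | y , e with y ≤? v
...   | yes y≤v = y , e , y≤v
...   | no y≰v  = ⊥-elim (<⇒≱ k<# (#≤-upper s k v e (≰⇒> y≰v)))

nth-#≤ : ∀ {xs} → Sorted xs → ∀ v → #≤ v xs < length xs → ∃[ y ] (nth (#≤ v xs) xs ≡ just y × v < y)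
nth-#≤ {xs} s v #<len with <⇒nth-just (#≤ v xs) xs #<len
... | y , e with y ≤? v
...   | yes y≤v = ⊥-elim (<-irrefl refl (#≤-lower s (#≤ v xs) v e y≤v))
...   | no y≰v  = y , e , ≰⇒> y≰v

#≤-exact : ∀ {xs} → Sorted xs → ∀ k v {x} → nth k xs ≡ just x → x ≤ v →
           (∀ z → nth (suc k) xs ≡ just z → v < z) → #≤ v xs ≡ suc k
#≤-exact {xs} s k v e x≤v next with nth (suc k) xs in e′
... | just z  = ≤-antisym (#≤-upper s (suc k) v e′ (next z refl)) (#≤-lower s k v e x≤v)
... | nothing = ≤-antisym (≤-trans (length-filter (_≤? v) xs) (nth-nothing⇒≤ (suc k) xs e′)) (#≤-lower s k v e x≤v)

#>-lower : ∀ {xs} → Sorted xs → ∀ k {y} v → nth k xs ≡ just y → v < y → length xs ∸ k ≤ #> v xs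
#>-lower {x ∷ xs} (x≤ ∷ s) zero v refl v<x =
  ≤-reflexive (sym (cong length (filter-all (v <?_) (v<x ∷ All.map (<-≤-trans v<x) x≤))))
#>-lower {x ∷ xs} (x≤ ∷ s) (suc k) v e v<y with v <? x
... | yes v<x rewrite length-filter-accept (v <?_) xs v<x = m≤n⇒m≤1+n (#>-lower s k v e v<y)
... | no v≮x  rewrite length-filter-reject (v <?_) xs v≮x = #>-lower s k v e v<y

-- Building the hat column

indexOf-just : ∀ x (C : List ℕ) {j} → indexOf x C ≡ just j → nth j C ≡ just x
indexOf-just x (y ∷ ys) e with x ≟ y
indexOf-just x (y ∷ ys) refl | yes refl = refl
... | no _ with indexOf x ys in eq
indexOf-just x (y ∷ ys) refl | no _ | just j = indexOf-just x ys eq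

indexOf-nothing : ∀ x (C : List ℕ) → indexOf x C ≡ nothing → x ∉ C
indexOf-nothing x (y ∷ ys) e x∈ with x ≟ y
indexOf-nothing x (y ∷ ys) () x∈ | yes _
... | no x≢y with indexOf x ys in eq | x∈
...   | nothing | here x≡y = x≢y x≡y
...   | nothing | there x∈ys = indexOf-nothing x ys eq x∈ys

isEmptyRow-true : ∀ j new → isEmptyRow j new ≡ true → nth j new ≡ just nothing
isEmptyRow-true j new e with nth j new
isEmptyRow-true j new e  | just nothing  = refl
isEmptyRow-true j new () | just (just _)
isEmptyRow-true j new () | nothing

isEmptyRow-false : ∀ j new → j < length new → isEmptyRow j new ≡ false → ∃[ y ] nth j new ≡ just (just y)
isEmptyRow-false j new j< e with nth j new in eq
isEmptyRow-false j new j< () | just nothing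
... | just (just y) = y , refl
... | nothing       = ⊥-elim (<⇒≱ j< (nth-nothing⇒≤ j new eq))

catMaybes-setAt : ∀ j x (new : List (Maybe ℕ)) → nth j new ≡ just nothing →
                  catMaybes (setAt j (just x) new) ↭ x ∷ catMaybes new
catMaybes-setAt zero    x (nothing ∷ ns) refl = ↭-refl
catMaybes-setAt (suc j) x (nothing ∷ ns) e    = catMaybes-setAt j x ns e
catMaybes-setAt (suc j) x (just y ∷ ns)  e    = ↭-trans (↭-prep y (catMaybes-setAt j x ns e)) (↭-swap y x ↭-refl)

candidates-∈ : ∀ k C′ new {j c} → (j , c) ∈ candidates k C′ new →
               ∃[ q ] (j ≡ k + q × nth q C′ ≡ just c × nth q new ≡ just nothing)
candidates-∈ k (c ∷ cs) (nothing ∷ ns) (here refl) = 0 , sym (+-identityʳ k) , refl , refl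
candidates-∈ k (c ∷ cs) (nothing ∷ ns) (there m) with candidates-∈ (suc k) cs ns m
... | q , refl , e , e′ = suc q , sym (+-suc k q) , e , e′
candidates-∈ k (c ∷ cs) (just _ ∷ ns) m with candidates-∈ (suc k) cs ns m
... | q , refl , e , e′ = suc q , sym (+-suc k q) , e , e′

#filled : List (Maybe ℕ) → ℕ
#filled new = length (catMaybes new)

-- In the second case every entry of C′ above v sits in a filled row, and these rows are
-- disjoint from the filled rows beyond C′.
vacant-above-or-crowded : ∀ v k C′ new → length C′ ≤ length new →
  (∃[ j ] ∃[ c ] ((j , c) ∈ candidates k C′ new × v < c)) ⊎ (#> v C′ + #filled (drop (length C′) new) ≤ #filled new)
vacant-above-or-crowded v k []       new          _ = inj₂ ≤-refl
vacant-above-or-crowded v k (c ∷ cs) (nothing ∷ ns) (s≤s len) with v <? c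
... | yes v<c = inj₁ (k , c , here refl , v<c)
... | no v≮c with vacant-above-or-crowded v (suc k) cs ns len
...   | inj₁ (j , c′ , m , v<c′) = inj₁ (j , c′ , there m , v<c′)
...   | inj₂ crowded rewrite length-filter-reject (v <?_) cs v≮c = inj₂ crowded
vacant-above-or-crowded v k (c ∷ cs) (just y ∷ ns) (s≤s len) with vacant-above-or-crowded v (suc k) cs ns len
... | inj₁ above = inj₁ above
... | inj₂ crowded with v <? c
...   | yes v<c rewrite length-filter-accept (v <?_) cs v<c = inj₂ (s≤s crowded)
...   | no v≮c  rewrite length-filter-reject (v <?_) cs v≮c = inj₂ (m≤n⇒m≤1+n crowded)

best-nothing : ∀ ps → best ps ≡ nothing → ps ≡ []
best-nothing []       _ = refl
best-nothing (p ∷ ps) e with best ps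
best-nothing (p ∷ ps) () | nothing
... | just q with proj₂ q ≤ᵇ proj₂ p
best-nothing (p ∷ ps) () | just q | true
best-nothing (p ∷ ps) () | just q | false

best-just : ∀ ps {r} → best ps ≡ just r → r ∈ ps × All (λ p → proj₂ p ≤ proj₂ r) ps
best-just (p ∷ ps) e with best ps in eq
best-just (p ∷ ps) refl | nothing = here refl , ≤-refl ∷ subst (All _) (sym (best-nothing ps eq)) []
... | just q with best-just ps eq | proj₂ q ≤ᵇ proj₂ p in q≤p
best-just (p ∷ ps) refl | just q | _      , ≤q | true  =
  here refl , ≤-refl ∷ All.map (λ ≤q′ → ≤-trans ≤q′ (≤ᵇ⇒≤ (proj₂ q) (proj₂ p) (Equivalence.from T-≡ q≤p))) ≤q
best-just (p ∷ ps) refl | just q | q∈ps , ≤q | false =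
  there q∈ps , <⇒≤ (≰⇒> (λ q≤p′ → subst Bool.T q≤p (≤⇒≤ᵇ q≤p′))) ∷ ≤q

VacantOrBelow : ℕ → Maybe (Maybe ℕ) → Set
VacantOrBelow c (just nothing)  = ⊤
VacantOrBelow c (just (just x)) = x < c
VacantOrBelow c nothing         = ⊥

-- The state of hatCol S C′ after placing the elements `placed` of S (the largest ones),
-- with `pending` still to come; `new` lists the rows of the hat column under construction.
record Placement (C′ : List ℕ) (L : ℕ) (placed pending : List ℕ) (new : List (Maybe ℕ)) : Set where
  field
    length≡        : length new ≡ L
    pending-vacant : ∀ q {c} → nth q C′ ≡ just c → c ∈ pending → nth q new ≡ just nothing
    placed-kept    : ∀ q {c} → nth q C′ ≡ just c → c ∈ placed → nth q new ≡ just (just c)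
    other-below    : ∀ q {c} → nth q C′ ≡ just c → c ∉ placed → VacantOrBelow c (nth q new)
    filled         : catMaybes new ↭ placed
open Placement

placement-start : ∀ C′ L pending → length C′ ≤ L → Placement C′ L [] pending (replicate L nothing)
placement-start C′ L pending l≤L = record
  { length≡        = length-replicate L
  ; pending-vacant = λ q e _ → vacant q e
  ; placed-kept    = λ _ _ ()
  ; other-below    = λ q e _ → subst (VacantOrBelow _) (sym (vacant q e)) tt
  ; filled         = ↭-reflexive (catMaybes-replicate L)
  }
  where
    catMaybes-replicate : ∀ L → catMaybes (replicate L nothing) ≡ []
    catMaybes-replicate zero    = refl
    catMaybes-replicate (suc L) = catMaybes-replicate L

    vacant : ∀ q {c} → nth q C′ ≡ just c → nth q (replicate L nothing) ≡ just nothing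
    vacant q e = nth-replicate nothing L q (<-≤-trans (nth-just⇒< q C′ e) l≤L)

placement-fill : ∀ {C′ L placed A b new} j → All (_< b) A → nth j new ≡ just nothing →
  (∀ {c} → nth j C′ ≡ just c → b ≤ c) → (∀ q → nth q C′ ≡ just b → q ≡ j) →
  Placement C′ L placed (A ++ [ b ]) new → Placement C′ L (b ∷ placed) A (setAt j (just b) new)
placement-fill {C′} {L} {placed} {A} {b} {new} j A<b vacant b≤C′j b-row inv = record
  { length≡        = trans (length-setAt j (just b) new) (length≡ inv)
  ; pending-vacant = pending-vacant′
  ; placed-kept    = placed-kept′
  ; other-below    = other-below′
  ; filled         = ↭-trans (catMaybes-setAt j b new vacant) (↭-prep b (filled inv))
  }
  where
    new′ = setAt j (just b) new

    at-j : nth j new′ ≡ just (just b)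
    at-j = nth-setAt-≡ j (just b) new (nth-just⇒< j new vacant)

    pending-vacant′ : ∀ q {c} → nth q C′ ≡ just c → c ∈ A → nth q new′ ≡ just nothing
    pending-vacant′ q e c∈A with q ≟ j
    ... | yes refl = ⊥-elim (<⇒≱ (All.lookup A<b c∈A) (b≤C′j e))
    ... | no q≢j   = trans (nth-setAt-≢ q j _ new q≢j) (pending-vacant inv q e (∈-++⁺ˡ c∈A))

    placed-kept′ : ∀ q {c} → nth q C′ ≡ just c → c ∈ b ∷ placed → nth q new′ ≡ just (just c)
    placed-kept′ q e (here refl) rewrite b-row q e = at-j
    placed-kept′ q e (there c∈placed) with q ≟ j
    ... | yes refl with () ← trans (sym (placed-kept inv q e c∈placed)) vacant
    ... | no q≢j   = trans (nth-setAt-≢ q j _ new q≢j) (placed-kept inv q e c∈placed)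

    other-below′ : ∀ q {c} → nth q C′ ≡ just c → c ∉ b ∷ placed → VacantOrBelow c (nth q new′)
    other-below′ q e c∉ with q ≟ j
    ... | yes refl = subst (VacantOrBelow _) (sym at-j) (≤∧≢⇒< (b≤C′j e) (λ b≡c → c∉ (here (sym b≡c))))
    ... | no q≢j   = subst (VacantOrBelow _) (sym (nth-setAt-≢ q j _ new q≢j)) (other-below inv q e (c∉ ∘ there))

drop-last : ∀ l (new : List (Maybe ℕ)) {y} → length new ≡ suc l → nth l new ≡ just y → drop l new ≡ [ y ]
drop-last zero    (m ∷ [])  refl refl = refl
drop-last (suc l) (m ∷ new) len  e    = drop-last l new (suc-injective len) e

extra-row-filled : ∀ l L new → length new ≡ L → (L ≡ l ⊎ L ≡ suc l) →
  ((L ≡ᵇ suc l) ∧ isEmptyRow l new) ≡ false → L ∸ l ≤ #filled (drop l new)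
extra-row-filled l L new len (inj₁ refl) _ = subst (_≤ #filled (drop l new)) (sym (n∸n≡0 l)) z≤n
extra-row-filled l L new len (inj₂ refl) extra
  with suc l ≡ᵇ suc l | ≡⇒≡ᵇ (suc l) (suc l) refl
... | true | _ with isEmptyRow-false l new (subst (l <_) (sym len) ≤-refl) extra
...   | y , e rewrite drop-last l new len e = ≤-reflexive (m+n∸n≡m 1 l)

vacant-above : ∀ {C′ L placed pending b new} → Placement C′ L placed pending new →
  (L ≡ length C′ ⊎ L ≡ suc (length C′)) → suc (length placed) ≤ (L ∸ length C′) + #> b C′ →
  ((L ≡ᵇ suc (length C′)) ∧ isEmptyRow (length C′) new) ≡ false →
  ∃[ j ] ∃[ c ] ((j , c) ∈ candidates 0 C′ new × b < c)
vacant-above {C′} {L} {placed} {_} {b} {new} inv len room extra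
  with vacant-above-or-crowded b 0 C′ new (subst (length C′ ≤_) (sym (length≡ inv)) (≡⊎≡suc⇒≤ len))
... | inj₁ above   = above
... | inj₂ crowded = ⊥-elim (<-irrefl refl (begin-strict
    length placed                                       <⟨ room ⟩
    (L ∸ length C′) + #> b C′                           ≤⟨ +-monoˡ-≤ _ (extra-row-filled _ L new (length≡ inv) len extra) ⟩
    #filled (drop (length C′) new) + #> b C′            ≡⟨ +-comm _ (#> b C′) ⟩
    #> b C′ + #filled (drop (length C′) new)            ≤⟨ crowded ⟩
    #filled new                                         ≡⟨ ↭-length (filled inv) ⟩
    length placed                                       ∎))
  where open ≤-Reasoning

best-candidate : ∀ C′ new {b} → (∃[ j ] ∃[ c ] ((j , c) ∈ candidates 0 C′ new × b < c)) →
  ∃[ j ] ∃[ c ] (best (candidates 0 C′ new) ≡ just (j , c) × nth j C′ ≡ just c × nth j new ≡ just nothing × b < c)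
best-candidate C′ new (j₀ , c₀ , m₀ , b<c₀) with best (candidates 0 C′ new) in eq
... | nothing with () ← subst ((j₀ , c₀) ∈_) (best-nothing _ eq) m₀
... | just (j , c) with best-just _ eq
...   | m , maximal with candidates-∈ 0 C′ new m
...     | q , refl , C′q , vacant = q , c , refl , C′q , vacant , <-≤-trans b<c₀ (All.lookup maximal m₀)

place-preserves : ∀ {C′ L A b placed new} → Unique C′ → (L ≡ length C′ ⊎ L ≡ suc (length C′)) → All (_< b) A →
  (b ∉ C′ → suc (length placed) ≤ (L ∸ length C′) + #> b C′) →
  Placement C′ L placed (A ++ [ b ]) new → Placement C′ L (b ∷ placed) A (place C′ L new b)
place-preserves {C′} {L} {A} {b} {placed} {new} uniq len A<b room inv with indexOf b C′ in eqI
... | just j = placement-fill j A<b (pending-vacant inv j C′j (∈-++⁺ʳ A (here refl)))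
                 (λ e → ≤-reflexive (nth-functional j C′ C′j e)) (λ q e → nth-injective uniq q j e C′j) inv
  where C′j = indexOf-just b C′ eqI
... | nothing with b∉C′ ← indexOf-nothing b C′ eqI
              with (L ≡ᵇ suc (length C′)) ∧ isEmptyRow (length C′) new in extra
...   | true  = placement-fill (length C′) A<b (isEmptyRow-true _ new (∧-trueʳ extra))
                  (λ e → ⊥-elim (<-irrefl refl (nth-just⇒< _ C′ e))) (λ q e → ⊥-elim (b∉C′ (nth-just⇒∈ q C′ e))) inv
  where
    ∧-trueʳ : ∀ {x y} → (x ∧ y) ≡ true → y ≡ true
    ∧-trueʳ {true} e = e
...   | false with best-candidate C′ new (vacant-above inv len (room b∉C′) extra)
...     | j , c , eqB , C′j , vacant , b<c rewrite eqB =
  placement-fill j A<b vacant (λ e → <⇒≤ (subst (b <_) (nth-functional j C′ C′j e) b<c))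
    (λ q e → ⊥-elim (b∉C′ (nth-just⇒∈ q C′ e))) inv

filled-map : ∀ (xs : List (Maybe ℕ)) → #filled xs ≡ length xs → map (fromMaybe 0) xs ≡ catMaybes xs
filled-map []             _ = refl
filled-map (just x ∷ xs)  e = cong (x ∷_) (filled-map xs (suc-injective e))
filled-map (nothing ∷ xs) e = ⊥-elim (<-irrefl e (s≤s (length-catMaybes xs)))

filled-nth : ∀ (xs : List (Maybe ℕ)) q → #filled xs ≡ length xs → nth q xs ≢ just nothing
filled-nth (just x ∷ xs)  (suc q) e e′ = filled-nth xs q (suc-injective e) e′
filled-nth (nothing ∷ xs) q       e _  = <-irrefl e (s≤s (length-catMaybes xs))

-- A Hall-type condition: each b ∈ S outside C′, together with the entries of S after it,
-- fits into the rows of C′ with entries above b and the extra row.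
EnoughRoom : List ℕ → List ℕ → Set
EnoughRoom S C′ = ∀ k {b} → nth k S ≡ just b → b ∉ C′ → length S ∸ k ≤ (length S ∸ length C′) + #> b C′

module HatColumn (S C′ : List ℕ) (S-increasing : AllPairs _<_ S) (C′-unique : Unique C′)
                 (len : length S ≡ length C′ ⊎ length S ≡ suc (length C′)) (room : EnoughRoom S C′) where

  private
    L = length S

    placement : ∀ B A → A ++ B ≡ S → Placement C′ L B A (foldl (place C′ L) (replicate L nothing) (reverse B))
    placement []      A _ = placement-start C′ L A (≡⊎≡suc⇒≤ len)
    placement (b ∷ B) A e rewrite unfold-reverse b B | foldl-++ (place C′ L) (replicate L nothing) (reverse B) [ b ] =
      place-preserves C′-unique len (allPairs-before A (subst (AllPairs _<_) (sym e) S-increasing)) room-b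
        (placement B (A ++ [ b ]) (trans (++-assoc A [ b ] B) e))
      where
        room-b : b ∉ C′ → suc (length B) ≤ (L ∸ length C′) + #> b C′
        room-b b∉C′ = subst (_≤ (L ∸ length C′) + #> b C′) L∸A (room (length A) S[A] b∉C′)
          where
            S[A] : nth (length A) S ≡ just b
            S[A] = subst (λ xs → nth (length A) xs ≡ just b) e (nth-++-length A)
            L∸A : L ∸ length A ≡ suc (length B)
            L∸A = trans (cong (λ xs → length xs ∸ length A) (sym e))
                        (trans (cong (_∸ length A) (length-++ A)) (m+n∸m≡n (length A) _))

    rows : List (Maybe ℕ)
    rows = foldl (place C′ L) (replicate L nothing) (reverse S)

    final : Placement C′ L S [] rows
    final = placement S [] refl

    rows-filled : #filled rows ≡ length rows
    rows-filled = trans (↭-length (filled final)) (sym (length≡ final))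

    nth-hatCol : ∀ q → nth q (hatCol S C′) ≡ Maybe.map (fromMaybe 0) (nth q rows)
    nth-hatCol q = nth-map (fromMaybe 0) q rows

  hatCol-↭ : hatCol S C′ ↭ S
  hatCol-↭ = subst (_↭ S) (sym (filled-map rows rows-filled)) (filled final)

  hatCol-common : ∀ q {c} → nth q C′ ≡ just c → c ∈ S → nth q (hatCol S C′) ≡ just c
  hatCol-common q e c∈S = trans (nth-hatCol q) (cong (Maybe.map (fromMaybe 0)) (placed-kept final q e c∈S))

  hatCol-below : ∀ q {c} → nth q C′ ≡ just c → c ∉ S → ∃[ x ] (nth q (hatCol S C′) ≡ just x × x < c)
  hatCol-below q e c∉S with nth q rows in eq | other-below final q e c∉S
  ... | just (just x) | x<c = x , trans (nth-hatCol q) (cong (Maybe.map (fromMaybe 0)) eq) , x<c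
  ... | just nothing  | _   = ⊥-elim (filled-nth rows q rows-filled eq)

-- Pivot intervals

Interval : Set
Interval = ℕ × Maybe ℕ

-- A pivot (b , d) is the closed interval [b, d] of the Non-overlapping Condition; for counting,
-- the half-open [b, d) is used instead, which is harmless because no b equals any d.
Covers : ℕ → Interval → Set
Covers v (b , just d)  = b ≤ v × v < d
Covers v (b , nothing) = b ≤ v

covers? : ∀ v p → Dec (Covers v p)
covers? v (b , just d)  = (b ≤? v) ×-dec (v <? d)
covers? v (b , nothing) = b ≤? v

#covering : ℕ → List Interval → ℕ
#covering v ps = length (filter (covers? v) ps)

Pointwise≤ : List ℕ → List ℕ → Set
Pointwise≤ C C′ = ∀ q {x y} → nth q C ≡ just x → nth q C′ ≡ just y → x ≤ y

#≤-pivots : ∀ v C C′ → Pointwise≤ C C′ → (length C ≡ length C′ ⊎ length C ≡ suc (length C′)) →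
            #≤ v C ≡ #≤ v C′ + #covering v (pivots C C′)
#≤-pivots v []           []       _    _ = refl
#≤-pivots v (c ∷ [])     []       _    _ with c ≤? v
... | yes c≤v rewrite length-filter-accept (_≤? v) [] c≤v | length-filter-accept (covers? v) [] c≤v = refl
... | no c≰v  rewrite length-filter-reject (_≤? v) [] c≰v | length-filter-reject (covers? v) [] c≰v = refl
#≤-pivots v []           (_ ∷ _)  _    (inj₁ ())
#≤-pivots v []           (_ ∷ _)  _    (inj₂ ())
#≤-pivots v (_ ∷ _ ∷ _)  []       _    (inj₁ ())
#≤-pivots v (_ ∷ _ ∷ _)  []       _    (inj₂ ())
#≤-pivots v (c ∷ cs)     (d ∷ ds) C≤C′ len
  with c <ᵇ d in c<ᵇd | ≤-<-connex c v | ≤-<-connex d v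
     | #≤-pivots v cs ds (C≤C′ ∘ suc) (Data.Sum.map suc-injective suc-injective len)
... | false | inj₁ c≤v | _ | ih
  rewrite length-filter-accept (_≤? v) cs c≤v
        | length-filter-accept (_≤? v) {d} ds (≤-trans (≮⇒≥ (λ c<d → subst Bool.T c<ᵇd (<⇒<ᵇ c<d))) c≤v) = cong suc ih
... | false | inj₂ v<c | _ | ih
  rewrite length-filter-reject (_≤? v) cs (<⇒≱ v<c)
        | length-filter-reject (_≤? v) ds (<⇒≱ (<-≤-trans v<c (C≤C′ 0 refl refl))) = ih
... | true | inj₁ c≤v | inj₁ d≤v | ih
  rewrite length-filter-accept (_≤? v) cs c≤v | length-filter-accept (_≤? v) ds d≤v
        | length-filter-reject (covers? v) {c , just d} (pivots cs ds) (λ cov → <⇒≱ (proj₂ cov) d≤v) = cong suc ih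
... | true | inj₁ c≤v | inj₂ v<d | ih
  rewrite length-filter-accept (_≤? v) cs c≤v | length-filter-reject (_≤? v) ds (<⇒≱ v<d)
        | length-filter-accept (covers? v) {c , just d} (pivots cs ds) (c≤v , v<d) = trans (cong suc ih) (sym (+-suc _ _))
... | true | inj₂ v<c | _ | ih
  rewrite length-filter-reject (_≤? v) cs (<⇒≱ v<c)
        | length-filter-reject (_≤? v) ds (<⇒≱ (<-trans v<c (<ᵇ⇒< c d (Equivalence.from T-≡ c<ᵇd))))
        | length-filter-reject (covers? v) {c , just d} (pivots cs ds) (<⇒≱ v<c ∘ proj₁) = ih

disjoint⇒¬covers-both : ∀ v p p′ → IntervalsDisjoint p p′ → Covers v p → ¬ Covers v p′
disjoint⇒¬covers-both v (b , just d)  (b′ , just d′) (inj₁ d<b′) (_ , v<d)  (b′≤v , _)  = <-asym d<b′ (≤-<-trans b′≤v v<d)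
disjoint⇒¬covers-both v (b , just d)  (b′ , just d′) (inj₂ d′<b) (b≤v , _)  (_ , v<d′)  = <-asym d′<b (≤-<-trans b≤v v<d′)
disjoint⇒¬covers-both v (b , just d)  (b′ , nothing) d<b′        (_ , v<d)  b′≤v        = <-asym d<b′ (≤-<-trans b′≤v v<d)
disjoint⇒¬covers-both v (b , nothing) (b′ , just d′) d′<b        b≤v        (_ , v<d′)  = <-asym d′<b (≤-<-trans b≤v v<d′)

disjoint⇒#covering≤1 : ∀ v ps → AllPairs IntervalsDisjoint ps → #covering v ps ≤ 1
disjoint⇒#covering≤1 v []       []           = z≤n
disjoint⇒#covering≤1 v (p ∷ ps) (p# ∷ ps#) with covers? v p
... | yes cov rewrite filter-none (covers? v) (All.map (λ p#p′ → disjoint⇒¬covers-both v p _ p#p′ cov) p#) = ≤-refl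
... | no _ = disjoint⇒#covering≤1 v ps ps#

Proper : Interval → Set
Proper (b , md) = ∀ {d} → md ≡ just d → b < d

_≢end_ : ℕ → Interval → Set
x ≢end (_ , md) = ∀ {d} → md ≡ just d → x ≢ d

disjoint? : ∀ p p′ → Dec (IntervalsDisjoint p p′)
disjoint? (b , just d)  (b′ , just d′) = (d <? b′) ⊎-dec (d′ <? b)
disjoint? (b , just d)  (b′ , nothing) = d <? b′
disjoint? (b , nothing) (b′ , just d′) = d′ <? b
disjoint? (b , nothing) (b′ , nothing) = no λ ()

covers-from : ∀ v b md → b ≤ v → (∀ {d} → md ≡ just d → v < d) → Covers v (b , md)
covers-from v b (just d) b≤v v<d = b≤v , v<d refl
covers-from v b nothing  b≤v _   = b≤v

ends-before : ∀ b {md d} p′ → md ≡ just d → d < proj₁ p′ → IntervalsDisjoint (b , md) p′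
ends-before b (b′ , just _)  refl d<b′ = inj₁ d<b′
ends-before b (b′ , nothing) refl d<b′ = d<b′

starts-after : ∀ p b′ {md′ d′} → md′ ≡ just d′ → d′ < proj₁ p → IntervalsDisjoint p (b′ , md′)
starts-after (b , just _)  b′ refl d′<b = inj₂ d′<b
starts-after (b , nothing) b′ refl d′<b = d′<b

-- Overlapping intervals share their larger left end, unless it is the other interval's right end.
overlap⇒common-point : ∀ p p′ → Proper p → Proper p′ → proj₁ p ≢end p′ → proj₁ p′ ≢end p →
                        ¬ IntervalsDisjoint p p′ → ∃[ v ] (Covers v p × Covers v p′)
overlap⇒common-point (b , md) (b′ , md′) b<d b′<d′ b≢d′ b′≢d ¬p#p′ with ≤-<-connex b b′
... | inj₁ b≤b′ =
  b′ , covers-from b′ b md b≤b′ (λ e → ≤∧≢⇒< (≮⇒≥ (¬p#p′ ∘ ends-before b (b′ , md′) e)) (b′≢d e))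
     , covers-from b′ b′ md′ ≤-refl b′<d′
... | inj₂ b′<b =
  b , covers-from b b md ≤-refl b<d
    , covers-from b b′ md′ (<⇒≤ b′<b) (λ e → ≤∧≢⇒< (≮⇒≥ (¬p#p′ ∘ starts-after (b , md) b′ e)) (b≢d′ e))

#covering-∷ : ∀ v p ps → #covering v ps ≤ #covering v (p ∷ ps)
#covering-∷ v p ps with covers? v p
... | yes _ = n≤1+n _
... | no _  = ≤-refl

#covering≤1⇒disjoint : ∀ ps → All Proper ps → (∀ {p p′} → p ∈ ps → p′ ∈ ps → proj₁ p ≢end p′) →
                       (∀ v → #covering v ps ≤ 1) → AllPairs IntervalsDisjoint ps
#covering≤1⇒disjoint []       _                _    _  = []
#covering≤1⇒disjoint (p ∷ ps) (p-proper ∷ proper) apart ≤1 =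
  All.tabulate disjoint-from-p
    ∷ #covering≤1⇒disjoint ps proper (λ m m′ → apart (there m) (there m′)) (λ v → ≤-trans (#covering-∷ v p ps) (≤1 v))
  where
    disjoint-from-p : ∀ {p′} → p′ ∈ ps → IntervalsDisjoint p p′
    disjoint-from-p {p′} m with disjoint? p p′
    ... | yes p#p′ = p#p′
    ... | no ¬p#p′
      with v , cov , cov′ ← overlap⇒common-point p p′ p-proper (All.lookup proper m)
                              (apart (here refl) (there m)) (apart (there m) (here refl)) ¬p#p′
      with covers? v p | ≤1 v
    ... | yes _   | ≤1v = ⊥-elim (<⇒≱ (s≤s (filter-some (covers? v) (lose m cov′))) ≤1v)
    ... | no ¬cov | _   = ⊥-elim (¬cov cov)

∈-pivots : ∀ C C′ {b md} → (b , md) ∈ pivots C C′ →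
           ∃[ q ] (nth q C ≡ just b × (∀ {d} → md ≡ just d → nth q C′ ≡ just d × b < d))
∈-pivots (c ∷ cs) []       (here refl) = 0 , refl , λ ()
∈-pivots (c ∷ cs) (d ∷ ds) m with c <ᵇ d in c<ᵇd | m
... | true  | here refl = 0 , refl , λ { refl → refl , <ᵇ⇒< c d (Equivalence.from T-≡ c<ᵇd) }
... | true  | there m′ with q , e , f ← ∈-pivots cs ds m′ = suc q , e , f
... | false | m′        with q , e , f ← ∈-pivots cs ds m′ = suc q , e , f

pivots-proper : ∀ C C′ → All Proper (pivots C C′)
pivots-proper C C′ = All.tabulate λ m → λ e → proj₂ (proj₂ (proj₂ (∈-pivots C C′ m)) e)

-- Adjacent columns

Descent : List ℕ → List ℕ → Set
Descent S S′ = ∃[ r ] ∃[ y ] ∃[ z ] (nth (suc r) S ≡ just y × nth r S′ ≡ just z × y < z)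

descent? : ∀ S S′ → Dec (Descent S S′)
descent? []      S′ = no λ { (_ , _ , _ , () , _) }
descent? (_ ∷ S) S′ = aligned? S S′
  where
    aligned? : ∀ xs ys → Dec (∃[ r ] ∃[ y ] ∃[ z ] (nth r xs ≡ just y × nth r ys ≡ just z × y < z))
    aligned? []       ys       = no λ { (_ , _ , _ , () , _) }
    aligned? (x ∷ xs) []       = no λ { (zero , _ , _ , _ , () , _) ; (suc _ , _ , _ , _ , () , _) }
    aligned? (x ∷ xs) (y ∷ ys) with x <? y | aligned? xs ys
    ... | yes x<y | _  = yes (0 , x , y , refl , refl , x<y)
    ... | no _    | yes (r , a , b , e , e′ , a<b) = yes (suc r , a , b , e , e′ , a<b)
    ... | no x≮y  | no ¬later = no λ
      { (zero  , _ , _ , refl , refl , x<y) → x≮y x<y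
      ; (suc r , a , b , e , e′ , a<b)      → ¬later (r , a , b , e , e′ , a<b) }

module Descents (S S′ : List ℕ) (S-sorted : Sorted S) (S′-sorted : Sorted S′)
                (len : length S ≡ length S′ ⊎ length S ≡ suc (length S′))
                (ps : List Interval) (split : ∀ v → #≤ v S ≡ #≤ v S′ + #covering v ps) where

  descent⇒twice-covered : Descent S S′ → ∃[ v ] 2 ≤ #covering v ps
  descent⇒twice-covered (r , y , z , Sy , S′z , y<z) = y , +-cancelˡ-≤ (#≤ y S′) 2 _ (begin
    #≤ y S′ + 2                 ≤⟨ +-monoˡ-≤ 2 (#≤-upper S′-sorted r y S′z y<z) ⟩
    r + 2                       ≡⟨ +-comm r 2 ⟩
    suc (suc r)                 ≤⟨ #≤-lower S-sorted (suc r) y Sy ≤-refl ⟩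
    #≤ y S                      ≡⟨ split y ⟩
    #≤ y S′ + #covering y ps    ∎)
    where open ≤-Reasoning

  twice-covered⇒descent : ∀ v → 2 ≤ #covering v ps → Descent S S′
  twice-covered⇒descent v twice = descent-at (<#≤⇒nth-≤ S-sorted (suc s) v ss≤) (nth-#≤ S′-sorted v s<len)
    where
      open ≤-Reasoning
      s = #≤ v S′
      descent-at : ∃[ y ] (nth (suc s) S ≡ just y × y ≤ v) → ∃[ z ] (nth s S′ ≡ just z × v < z) → Descent S S′
      descent-at (y , Sy , y≤v) (z , S′z , v<z) = s , y , z , Sy , S′z , ≤-<-trans y≤v v<z
      ss≤ : suc (suc s) ≤ #≤ v S
      ss≤ = begin
        suc (suc s)             ≡⟨ +-comm 2 s ⟩
        s + 2                   ≤⟨ +-monoʳ-≤ s twice ⟩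
        s + #covering v ps      ≡⟨ split v ⟨
        #≤ v S                  ∎
      s<len : s < length S′
      s<len = ≤-pred (begin
        suc (suc s)             ≤⟨ ss≤ ⟩
        #≤ v S                  ≤⟨ length-filter (_≤? v) S ⟩
        length S                ≤⟨ [ (λ e → ≤-trans (≤-reflexive e) (n≤1+n _)) , ≤-reflexive ]′ len ⟩
        suc (length S′)         ∎)

record AdjacentColumns (S S′ : List ℕ) : Set where
  field
    left-increasing  : AllPairs _<_ S
    right-increasing : AllPairs _<_ S′
    lengths          : length S ≡ length S′ ⊎ length S ≡ suc (length S′)
    rows-weak        : Pointwise≤ S S′

  left-sorted : Sorted S
  left-sorted = AllPairs.map <⇒≤ left-increasing

  right-sorted : Sorted S′
  right-sorted = AllPairs.map <⇒≤ right-increasing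

  -- An entry b of S missing from S′ lies strictly below S′ in its row, hence below all
  -- entries of S′ from that row on.
  adjacent-room : EnoughRoom S S′
  adjacent-room k {b} Sb b∉S′ with <-≤-connex k (length S′)
  ... | inj₂ l≤k = ≤-trans (∸-monoʳ-≤ (length S) l≤k) (m≤m+n _ _)
  ... | inj₁ k<l with z , S′z ← <⇒nth-just k S′ k<l = begin
      length S ∸ k                           ≡⟨ cong (_∸ k) (m∸n+n≡m (≡⊎≡suc⇒≤ lengths)) ⟨
      (length S ∸ l + l) ∸ k                 ≡⟨ +-∸-assoc (length S ∸ l) (<⇒≤ k<l) ⟩
      (length S ∸ l) + (l ∸ k)               ≤⟨ +-monoʳ-≤ (length S ∸ l) (#>-lower right-sorted k b S′z b<z) ⟩
      (length S ∸ l) + #> b S′               ∎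
    where
      open ≤-Reasoning
      l = length S′
      b<z : b < z
      b<z = ≤∧≢⇒< (rows-weak k Sb S′z) (λ { refl → b∉S′ (nth-just⇒∈ k S′ S′z) })

EnoughRoom-resp-↭ : ∀ {S C′ S′} → C′ ↭ S′ → EnoughRoom S S′ → EnoughRoom S C′
EnoughRoom-resp-↭ {S} {C′} {S′} C′↭S′ room k {b} Sb b∉C′ =
  subst₂ (λ l m → length S ∸ k ≤ (length S ∸ l) + m) (sym (↭-length C′↭S′)) (sym (#>-↭ b C′↭S′))
    (room k Sb (b∉C′ ∘ ∈-resp-↭ (↭-sym C′↭S′)))

module ColumnPair {S S′ C′ : List ℕ} (adj : AdjacentColumns S S′) (C′↭S′ : C′ ↭ S′) where
  open AdjacentColumns adj

  private
    lengths′ : length S ≡ length C′ ⊎ length S ≡ suc (length C′)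
    lengths′ = subst (λ l → length S ≡ l ⊎ length S ≡ suc l) (sym (↭-length C′↭S′)) lengths

    C′-unique : Unique C′
    C′-unique = ↭ₛ.Unique-resp-↭ (setoid ℕ) (↭⇒↭ₛ (↭-sym C′↭S′)) (AllPairs.map <⇒≢ right-increasing)

  open HatColumn S C′ left-increasing C′-unique lengths′ (EnoughRoom-resp-↭ {S} C′↭S′ adjacent-room) public

  private
    C = hatCol S C′
    ps = pivots C C′

    C-lengths : length C ≡ length C′ ⊎ length C ≡ suc (length C′)
    C-lengths = subst (λ l → l ≡ length C′ ⊎ l ≡ suc (length C′)) (sym (↭-length hatCol-↭)) lengths′

    C≤C′ : Pointwise≤ C C′
    C≤C′ q {x} {y} Cx C′y with y ∈? S
    ... | yes y∈S = ≤-reflexive (nth-functional q C Cx (hatCol-common q C′y y∈S))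
    ... | no y∉S with x′ , Cx′ , x′<y ← hatCol-below q C′y y∉S = <⇒≤ (subst (_< y) (nth-functional q C Cx′ Cx) x′<y)

    split : ∀ v → #≤ v S ≡ #≤ v S′ + #covering v ps
    split v = begin
      #≤ v S                      ≡⟨ #≤-↭ v hatCol-↭ ⟨
      #≤ v C                      ≡⟨ #≤-pivots v C C′ C≤C′ C-lengths ⟩
      #≤ v C′ + #covering v ps    ≡⟨ cong (_+ #covering v ps) (#≤-↭ v C′↭S′) ⟩
      #≤ v S′ + #covering v ps    ∎
      where open ≡-Reasoning

    -- Left ends of pivots are entries of C, right ends are entries of C′ missing from S.
    pivots-apart : ∀ {p p′} → p ∈ ps → p′ ∈ ps → proj₁ p ≢end p′
    pivots-apart {b , _} {_ , md′} m m′ {d′} e b≡d′ with q , Cb , _ ← ∈-pivots C C′ m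
                                                 | q′ , Cb′ , ends ← ∈-pivots C C′ m′
      with C′d′ , b′<d′ ← ends e = <⇒≢ b′<d′ (nth-functional q′ C Cb′ (hatCol-common q′ C′d′ d′∈S))
      where
        d′∈S : d′ ∈ S
        d′∈S = ∈-resp-↭ hatCol-↭ (subst (_∈ C) b≡d′ (nth-just⇒∈ q C Cb))

  open Descents S S′ left-sorted right-sorted lengths ps split

  descent⇒¬nonOverlapping : Descent S S′ → ¬ NonOverlapping C C′
  descent⇒¬nonOverlapping d nonOverlapping with v , twice ← descent⇒twice-covered d =
    <⇒≱ twice (at-most-once nonOverlapping)
    where
      at-most-once : NonOverlapping C C′ → #covering v ps ≤ 1
      at-most-once (inj₁ ≤1)  = ≤-trans (length-filter (covers? v) ps) ≤1
      at-most-once (inj₂ ps#) = disjoint⇒#covering≤1 v ps ps#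

  ¬nonOverlapping⇒descent : ¬ NonOverlapping C C′ → Descent S S′
  ¬nonOverlapping⇒descent ¬no with descent? S S′
  ... | yes d  = d
  ... | no ¬d = ⊥-elim (¬no (inj₂ (#covering≤1⇒disjoint ps (pivots-proper C C′) pivots-apart
                                    (λ v → ≮⇒≥ (¬d ∘ twice-covered⇒descent v)))))

rootCols-↭ : ∀ {cs} → Linked AdjacentColumns cs → Pointwise _↭_ (rootCols cs) cs
rootCols-↭ []  = []
rootCols-↭ [-] = ↭-refl ∷ []
rootCols-↭ {c ∷ c′ ∷ cs} (adj ∷ rest) with rootCols (c′ ∷ cs) | rootCols-↭ rest
... | h ∷ hs | h↭c′ ∷ hs↭ = ColumnPair.hatCol-↭ adj h↭c′ ∷ h↭c′ ∷ hs↭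

nth-rootCols : ∀ cs k {c h} → nth k cs ≡ just c → nth (suc k) (rootCols cs) ≡ just h →
               nth k (rootCols cs) ≡ just (hatCol c h)
nth-rootCols (c ∷ cs) k e e′ with rootCols cs in eq
nth-rootCols (c ∷ cs) zero    refl refl | h ∷ _ = refl
nth-rootCols (c ∷ cs) (suc k) e    e′   | _ ∷ _ =
  subst (λ R → nth k R ≡ _) eq (nth-rootCols cs k e (trans (cong (nth (suc k)) eq) e′))

rootCols-pair-nonOverlapping : ∀ {cs} → Linked AdjacentColumns cs →
  ∀ k {c c′} → nth k cs ≡ just c → nth (suc k) cs ≡ just c′ →
  (¬ NonOverlapping (fromMaybe [] (nth k (rootCols cs))) (fromMaybe [] (nth (suc k) (rootCols cs)))) ⇔ Descent c c′
rootCols-pair-nonOverlapping {cs} linked k {c} {c′} e e′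
  with h , root[k+1] , h↭c′ ← pointwise-nth (rootCols-↭ linked) (suc k) e′
  rewrite root[k+1] | nth-rootCols cs k e root[k+1] =
  mk⇔ ¬nonOverlapping⇒descent descent⇒¬nonOverlapping
  where open ColumnPair (linked-nth linked k e e′) h↭c′

-- Walls

-- Of the four wall-existence tests in countedPair only 1 ≤ r ≤ j and j + 2 ≤ n carry information.
record CountedPair (n : ℕ) (T : Tableau) (r j : ℕ) : Set where
  field
    1≤r         : 1 ≤ r
    r≤j         : r ≤ j
    j+2≤n       : suc (suc j) ≤ n
    level       : P T r j ≡ P T r (suc j)
    below-left  : P T (suc r) (suc j) ≡ P T r j
    below-right : P T (suc r) (suc (suc j)) ≡ P T r j

module _ {n : ℕ} {T : Tableau} {r j : ℕ} where
  private
    ∧⁻ : ∀ x {y} → Bool.T (x ∧ y) → Bool.T x × Bool.T y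
    ∧⁻ true t = _ , t

    ∧⁺ : ∀ {x y} → Bool.T x → Bool.T y → Bool.T (x ∧ y)
    ∧⁺ x y = Equivalence.from T-∧ (x , y)

    wall⁺ : ∀ {r k} → 1 ≤ r → r ≤ k → k ≤ n → Bool.T (wall n r k)
    wall⁺ 1≤r r≤k k≤n = ∧⁺ (≤⇒≤ᵇ 1≤r) (∧⁺ (≤⇒≤ᵇ r≤k) (≤⇒≤ᵇ k≤n))

    ≡⁻ : ∀ {a b} → Bool.T (a ≡ᵇ b) → a ≡ b
    ≡⁻ = ≡ᵇ⇒≡ _ _

  countedPair-sound : Bool.T (countedPair n T r j) → CountedPair n T r j
  countedPair-sound h
    with w₁ , h₁ ← ∧⁻ (wall n r j) h
    with _  , h₂ ← ∧⁻ (wall n r (suc j)) h₁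
    with _  , h₃ ← ∧⁻ (wall n (suc r) (suc j)) h₂
    with w₄ , h₄ ← ∧⁻ (wall n (suc r) (suc (suc j))) h₃
    with e₁ , h₅ ← ∧⁻ (P T r j ≡ᵇ P T r (suc j)) h₄
    with e₂ , e₃ ← ∧⁻ (P T (suc r) (suc j) ≡ᵇ P T r j) h₅
    with 1≤r , r≤j≤n ← ∧⁻ (1 ≤ᵇ r) w₁
    with r≤j , _ ← ∧⁻ (r ≤ᵇ j) r≤j≤n
    with _ , j+2≤n ← ∧⁻ (suc r ≤ᵇ suc (suc j)) (proj₂ (∧⁻ (1 ≤ᵇ suc r) w₄))
    = record { 1≤r = ≤ᵇ⇒≤ 1 r 1≤r ; r≤j = ≤ᵇ⇒≤ r j r≤j ; j+2≤n = ≤ᵇ⇒≤ _ n j+2≤n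
             ; level = ≡⁻ e₁ ; below-left = ≡⁻ e₂ ; below-right = ≡⁻ e₃ }

  countedPair-complete : CountedPair n T r j → Bool.T (countedPair n T r j)
  countedPair-complete c =
    ∧⁺ (wall⁺ 1≤r r≤j j≤n) (∧⁺ (wall⁺ 1≤r (m≤n⇒m≤1+n r≤j) j+1≤n)
      (∧⁺ (wall⁺ (s≤s z≤n) (s≤s r≤j) j+1≤n)
      (∧⁺ (wall⁺ (s≤s z≤n) (m≤n⇒m≤1+n (s≤s r≤j)) j+2≤n)
      (∧⁺ (≡⇒≡ᵇ _ _ level) (∧⁺ (≡⇒≡ᵇ _ _ below-left) (≡⇒≡ᵇ _ _ below-right))))))
    where
      open CountedPair c
      j+1≤n = ≤-trans (n≤1+n _) j+2≤n
      j≤n = ≤-trans (n≤1+n _) j+1≤n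

0<sum⇒∈ : ∀ xs → 0 < sum xs → ∃[ x ] (x ∈ xs × 0 < x)
0<sum⇒∈ (zero  ∷ xs) pos with x , x∈ , 0<x ← 0<sum⇒∈ xs pos = x , there x∈ , 0<x
0<sum⇒∈ (suc x ∷ xs) _   = suc x , here refl , s≤s z≤n

∈⇒0<sum : ∀ {xs x} → x ∈ xs → 0 < x → 0 < sum xs
∈⇒0<sum {y ∷ xs} (here refl) 0<y = ≤-trans 0<y (m≤m+n y (sum xs))
∈⇒0<sum {y ∷ xs} (there x∈) 0<x = ≤-trans (∈⇒0<sum x∈ 0<x) (m≤n+m (sum xs) y)

0<indicator⇔ : ∀ b → (0 < (if b then 1 else 0)) ⇔ Bool.T b
0<indicator⇔ true  = mk⇔ _ (λ _ → s≤s z≤n)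
0<indicator⇔ false = mk⇔ (λ ()) (λ ())

∈-oneTo : ∀ {r n} → 1 ≤ r → r ≤ n → r ∈ oneTo n
∈-oneTo {suc r} _ r<n = ∈-map⁺ suc (∈-upTo⁺ r<n)

0<nT⇔countedPair : ∀ n T → (0 < nT n T) ⇔ (∃[ r ] ∃[ j ] CountedPair n T r j)
0<nT⇔countedPair n T = mk⇔ to from
  where
    indicator : ℕ → ℕ → ℕ
    indicator r j = if countedPair n T r j then 1 else 0

    row : ℕ → List ℕ
    row r = map (indicator r) (oneTo n)

    to : 0 < nT n T → ∃[ r ] ∃[ j ] CountedPair n T r j
    to pos with x , x∈ , 0<x ← 0<sum⇒∈ _ pos
           with r , x∈row ← satisfied (∈-concatMap⁻ row {xs = oneTo n} x∈)
           with j , _ , refl ← ∈-map⁻ (indicator r) x∈row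
      = r , j , countedPair-sound (Equivalence.to (0<indicator⇔ (countedPair n T r j)) 0<x)

    from : ∃[ r ] ∃[ j ] CountedPair n T r j → 0 < nT n T
    from (r , j , c) = ∈⇒0<sum (∈-concatMap⁺ row (lose r∈ (∈-map⁺ (indicator r) j∈)))
                         (Equivalence.from (0<indicator⇔ (countedPair n T r j)) (countedPair-complete c))
      where
        open CountedPair c
        r∈ = ∈-oneTo 1≤r (≤-trans r≤j (≤-trans (n≤1+n j) (≤-trans (n≤1+n _) j+2≤n)))
        j∈ = ∈-oneTo (≤-trans 1≤r r≤j) (≤-trans (n≤1+n j) (≤-trans (n≤1+n _) j+2≤n))

-- Tableaux of shape μ

mu-length : ∀ m lam → length lam ≡ m → length (mu m lam) ≡ m
mu-length m lam refl = trans (length-zipWith _+_ lam (downFrom m)) (trans (cong (m ⊓_) (length-downFrom m)) (⊓-idem m))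

mu-decreasing : ∀ m lam → length lam ≡ m → Linked _≥_ lam → Linked _>_ (mu m lam)
mu-decreasing zero          []              _  _           = []
mu-decreasing (suc zero)    (a ∷ [])        _  _           = [-]
mu-decreasing (suc (suc m)) (a ∷ b ∷ lam)   len (b≤a ∷ lin) =
  +-mono-≤-< b≤a (n<1+n m) ∷ mu-decreasing (suc m) (b ∷ lam) (suc-injective len) lin

entry-row : ∀ T ρ c {R} → nth ρ T ≡ just R → entry T ρ c ≡ nth c R
entry-row T ρ c e rewrite e = refl

entry-just : ∀ T ρ c {x} → entry T ρ c ≡ just x → ∃[ R ] (nth ρ T ≡ just R × nth c R ≡ just x)
entry-just T ρ c e with nth ρ T
... | just R = R , refl , e

entry-left : ∀ T q c {y} → entry T q (suc c) ≡ just y → ∃[ x ] entry T q c ≡ just x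
entry-left T q c Ty with R , T[q] , Ry ← entry-just T q (suc c) Ty
                    with x , Rx ← <⇒nth-just c R (<-trans (n<1+n c) (nth-just⇒< (suc c) R Ry))
  = x , trans (entry-row T q c T[q]) Rx

short-rows-mapMaybe : ∀ c (Ts : List (List ℕ)) → All (λ R → length R ≤ c) Ts → mapMaybe (nth c) Ts ≡ []
short-rows-mapMaybe c []       []          = refl
short-rows-mapMaybe c (R ∷ Ts) (R≤c ∷ Ts≤c) rewrite ≤⇒nth-nothing c R R≤c = short-rows-mapMaybe c Ts Ts≤c

short-rows-entry : ∀ c (Ts : List (List ℕ)) → All (λ R → length R ≤ c) Ts → ∀ q → entry Ts q c ≡ nothing
short-rows-entry c []       []         q       = refl
short-rows-entry c (R ∷ Ts) (R≤c ∷ _)  zero    = ≤⇒nth-nothing c R R≤c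
short-rows-entry c (R ∷ Ts) (_ ∷ Ts≤c) (suc q) = short-rows-entry c Ts Ts≤c q

rows-below-short : ∀ c {R : List ℕ} {Ts} → Linked (λ R R′ → length R′ ≤ length R) (R ∷ Ts) → length R ≤ c →
                   All (λ R′ → length R′ ≤ c) (R ∷ Ts)
rows-below-short c lin R≤c =
  R≤c ∷ All.map (λ R′≤R → ≤-trans R′≤R R≤c) (AllPairs.head (Linked⇒AllPairs (λ p q → ≤-trans q p) lin))

nth-column : ∀ c Ts → Linked (λ R R′ → length R′ ≤ length R) Ts → ∀ q → nth q (mapMaybe (nth c) Ts) ≡ entry Ts q c
nth-column c []       _   q = refl
nth-column c (R ∷ Ts) lin q with nth c R in Rc | q
... | just x  | zero   = sym Rc
... | just x  | suc q′ = nth-column c Ts (Linked.tail lin) q′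
... | nothing | q      with short ← rows-below-short c lin (nth-nothing⇒≤ c R Rc) =
  trans (cong (nth q) (short-rows-mapMaybe c Ts (All.tail short))) (sym (short-rows-entry c (R ∷ Ts) short q))

-- Rows ρ and columns k are 0-based, as in `entry`.
TableauDescent : Tableau → Set
TableauDescent T = ∃[ k ] ∃[ ρ ] ∃[ y ] ∃[ z ] (entry T (suc ρ) k ≡ just y × entry T ρ (suc k) ≡ just z × y < z)

module Tableaux {n : ℕ} {lam : List ℕ} {T : Tableau} (lam-length : length lam ≡ n) (lam-decreasing : Linked _≥_ lam)
                (ssyt : IsSSYT n (mu n lam) T) where
  open IsSSYT ssyt

  rows-decreasing : Linked (λ R R′ → length R > length R′) T
  rows-decreasing = Linked.map⁻ (subst (Linked _>_) (sym shape)
                      (mu-decreasing n lam lam-length lam-decreasing))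

  length-rows : length T ≡ n
  length-rows = trans (sym (length-map length T)) (trans (cong length shape) (mu-length n lam lam-length))

  row : ∀ ρ → ρ < n → ∃[ R ] nth ρ T ≡ just R
  row ρ ρ<n = <⇒nth-just ρ T (subst (ρ <_) (sym length-rows) ρ<n)

  entry-above : ∀ ρ c {y} → entry T (suc ρ) c ≡ just y → ∃[ x ] (entry T ρ c ≡ just x × x < y)
  entry-above ρ c {y} Ty
    with R′ , T[ρ+1] , R′y ← entry-just T (suc ρ) c Ty
    with R , T[ρ] ← <⇒nth-just ρ T (<-trans (n<1+n ρ) (nth-just⇒< (suc ρ) T T[ρ+1]))
    with x , Rx ← <⇒nth-just c R (<-trans (nth-just⇒< c R′ R′y) (linked-nth rows-decreasing ρ T[ρ] T[ρ+1]))
    = x , Tx , colsStrict ρ c x y Tx Ty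
    where Tx = trans (entry-row T ρ c T[ρ]) Rx

  entry-lower : ∀ ρ c {x} → entry T ρ c ≡ just x → suc ρ ≤ x
  entry-lower zero    c Tx = proj₁ (entries 0 c _ Tx)
  entry-lower (suc ρ) c Ty with x , Tx , x<y ← entry-above ρ c Ty = <-≤-trans (s≤s (entry-lower ρ c Tx)) x<y

  first-entry : ∀ ρ → suc ρ < n → ∃[ x ] entry T ρ 0 ≡ just x
  first-entry ρ ρ+1<n
    with R , T[ρ] ← row ρ (<-trans (n<1+n ρ) ρ+1<n) | R′ , T[ρ+1] ← row (suc ρ) ρ+1<n
    with x , Rx ← <⇒nth-just 0 R (≤-<-trans z≤n (linked-nth rows-decreasing ρ T[ρ] T[ρ+1]))
    = x , trans (entry-row T ρ 0 T[ρ]) Rx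

  -- The first column has n − 1 strictly increasing entries in [n].
  first-column-bound : ∀ d ρ {x} → suc (suc (ρ + d)) ≡ n → entry T ρ 0 ≡ just x → x + d ≤ n
  first-column-bound zero    ρ {x} _ Tx = ≤-trans (≤-reflexive (+-identityʳ x)) (proj₂ (entries ρ 0 x Tx))
  first-column-bound (suc d) ρ {x} e Tx = below (first-entry (suc ρ) ρ+2<n)
    where
      open ≤-Reasoning
      e′ : suc (suc (suc ρ + d)) ≡ n
      e′ = trans (cong (suc ∘ suc) (sym (+-suc ρ d))) e
      ρ+2<n : suc (suc ρ) < n
      ρ+2<n = subst (suc (suc (suc ρ)) ≤_) e′ (s≤s (s≤s (s≤s (m≤m+n ρ d))))
      below : ∃[ x′ ] entry T (suc ρ) 0 ≡ just x′ → x + suc d ≤ n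
      below (x′ , Tx′) = begin
        x + suc d      ≡⟨ +-suc x d ⟩
        suc x + d      ≤⟨ +-monoˡ-≤ d (colsStrict ρ 0 x x′ Tx Tx′) ⟩
        x′ + d         ≤⟨ first-column-bound d (suc ρ) e′ Tx′ ⟩
        n              ∎

  first-entry≤ : ∀ ρ {x} → suc ρ < n → entry T ρ 0 ≡ just x → x ≤ suc (suc ρ)
  first-entry≤ ρ {x} ρ+1<n Tx =
    +-cancelʳ-≤ d x (suc (suc ρ)) (≤-trans (first-column-bound d ρ ρ+2+d≡n Tx) (≤-reflexive (sym ρ+2+d≡n)))
    where
      d = n ∸ suc (suc ρ)
      ρ+2+d≡n : suc (suc (ρ + d)) ≡ n
      ρ+2+d≡n = m+[n∸m]≡n ρ+1<n

  row-sorted : ∀ ρ {R} → nth ρ T ≡ just R → Sorted R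
  row-sorted ρ {R} T[ρ] = Linked⇒AllPairs ≤-trans (nth⇒linked R (λ c {x} {y} Rx Ry →
    rowsWeak ρ c x y (trans (entry-row T ρ c T[ρ]) Rx) (trans (entry-row T ρ (suc c) T[ρ]) Ry)))

  P-row : ∀ ρ {R} → nth ρ T ≡ just R → ∀ v → P T (suc ρ) v ≡ #≤ v R
  P-row ρ T[ρ] v rewrite T[ρ] = refl

  P-row-exact : ∀ ρ {R} k v {x} → nth ρ T ≡ just R → nth k R ≡ just x → x ≤ v →
                (∀ w → nth (suc k) R ≡ just w → v < w) → P T (suc ρ) v ≡ suc k
  P-row-exact ρ k v T[ρ] Rx x≤v next = trans (P-row ρ T[ρ] v) (#≤-exact (row-sorted ρ T[ρ]) k v Rx x≤v next)

  -- Equal wall positions give an entry ≤ j+1 in row r+1 directly left of the wall and an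
  -- entry > j+1 in row r directly right of it; the position is not 0 because the first entry
  -- of row r is at most r + 1 ≤ j + 1.
  module _ {ρ j : ℕ} (c : CountedPair n T (suc ρ) j) where
    open CountedPair c

    private
      ρ+1<n : suc ρ < n
      ρ+1<n = ≤-trans (s≤s r≤j) (≤-trans (n≤1+n _) j+2≤n)
      R      = proj₁ (row ρ (<-trans (n<1+n ρ) ρ+1<n))
      T[ρ]   = proj₂ (row ρ (<-trans (n<1+n ρ) ρ+1<n))
      R′     = proj₁ (row (suc ρ) ρ+1<n)
      T[ρ+1] = proj₂ (row (suc ρ) ρ+1<n)

      same : #≤ (suc j) R′ ≡ #≤ (suc j) R
      same = trans (sym (P-row (suc ρ) T[ρ+1] (suc j))) (trans below-left (trans level (P-row ρ T[ρ] (suc j))))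

      first-counted : ∃[ x ] entry T ρ 0 ≡ just x → 0 < #≤ (suc j) R
      first-counted (x , Tx) = #≤-lower (row-sorted ρ T[ρ]) 0 (suc j) (trans (sym (entry-row T ρ 0 T[ρ])) Tx)
                                 (≤-trans (first-entry≤ ρ ρ+1<n Tx) (s≤s r≤j))

      #R<len : #≤ (suc j) R < length R
      #R<len = ≤-<-trans (≤-trans (≤-reflexive (sym same)) (length-filter (_≤? suc j) R′))
                         (linked-nth rows-decreasing ρ T[ρ] T[ρ+1])

      descent : ∀ p → #≤ (suc j) R ≡ suc p → ∃[ y ] (nth p R′ ≡ just y × y ≤ suc j) →
                ∃[ z ] (nth (#≤ (suc j) R) R ≡ just z × suc j < z) → TableauDescent T
      descent p #R (y , R′y , y≤) (z , Rz , <z) =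
        p , ρ , y , z , trans (entry-row T (suc ρ) p T[ρ+1]) R′y ,
        trans (entry-row T ρ (suc p) T[ρ]) (subst (λ i → nth i R ≡ just z) #R Rz) , ≤-<-trans y≤ <z

    countedPair⇒descent : TableauDescent T
    countedPair⇒descent with #≤ (suc j) R in #R
    ... | zero  = ⊥-elim (<⇒≱ (first-counted (first-entry ρ ρ+1<n)) (≤-reflexive #R))
    ... | suc p = descent p #R (<#≤⇒nth-≤ (row-sorted (suc ρ) T[ρ+1]) p (suc j) (≤-reflexive (sym (trans same #R))))
                               (nth-#≤ (row-sorted ρ T[ρ]) (suc j) #R<len)

  -- Around an entry y = j+1 of row r+1 lying below-left of a larger entry z of row r,
  -- all four walls |_j, |_{j+1} (row r) and |_{j+1}, |_{j+2} (row r+1) sit after column k.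
  descent⇒countedPair : TableauDescent T → ∃[ r ] ∃[ j ] CountedPair n T r j
  descent⇒countedPair (k , ρ , zero , z , Ty , Tz , y<z) = ⊥-elim (<⇒≱ (s≤s z≤n) (entry-lower (suc ρ) k Ty))
  descent⇒countedPair (k , ρ , suc j , z , Ty , Tz , y<z)
    with R′ , T[ρ+1] , R′y ← entry-just T (suc ρ) k Ty
       | R , T[ρ] , Rz ← entry-just T ρ (suc k) Tz
       | x , Tx , x<y ← entry-above ρ k Ty
    = suc ρ , j , record
      { 1≤r         = s≤s z≤n
      ; r≤j         = ≤-pred (entry-lower (suc ρ) k Ty)
      ; j+2≤n       = ≤-trans y<z (proj₂ (entries ρ (suc k) z Tz))
      ; level       = trans P[r,j] (sym P[r,j+1])
      ; below-left  = trans P[r+1,j+1] (sym P[r,j])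
      ; below-right = trans P[r+1,j+2] (sym P[r,j])
      }
    where
      Rx : nth k R ≡ just x
      Rx = trans (sym (entry-row T ρ k T[ρ])) Tx
      right-of-x : ∀ {v} → v < z → ∀ w → nth (suc k) R ≡ just w → v < w
      right-of-x v<z w Rw = subst (_ <_) (nth-functional (suc k) R Rz Rw) v<z
      right-of-y : ∀ {v} → v ≤ z → ∀ w → nth (suc k) R′ ≡ just w → v < w
      right-of-y v≤z w R′w = ≤-<-trans v≤z (colsStrict ρ (suc k) z w Tz (trans (entry-row T (suc ρ) (suc k) T[ρ+1]) R′w))
      P[r,j]     = P-row-exact ρ k j T[ρ] Rx (≤-pred x<y) (right-of-x (<-trans (n<1+n j) y<z))
      P[r,j+1]   = P-row-exact ρ k (suc j) T[ρ] Rx (<⇒≤ x<y) (right-of-x y<z)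
      P[r+1,j+1] = P-row-exact (suc ρ) k (suc j) T[ρ+1] R′y ≤-refl (right-of-y (<⇒≤ y<z))
      P[r+1,j+2] = P-row-exact (suc ρ) k (suc (suc j)) T[ρ+1] R′y (n≤1+n _) (right-of-y y<z)

  entry-above-right : ∀ ρ c {y} → entry T (suc ρ) c ≡ just y → ∃[ x ] entry T ρ (suc c) ≡ just x
  entry-above-right ρ c Ty
    with R′ , T[ρ+1] , R′y ← entry-just T (suc ρ) c Ty
    with R , T[ρ] ← <⇒nth-just ρ T (<-trans (n<1+n ρ) (nth-just⇒< (suc ρ) T T[ρ+1]))
    with x , Rx ← <⇒nth-just (suc c) R (≤-trans (s≤s (nth-just⇒< c R′ R′y)) (linked-nth rows-decreasing ρ T[ρ] T[ρ+1]))
    = x , trans (entry-row T ρ (suc c) T[ρ]) Rx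

  width-bound : ∀ ρ c {x} → entry T ρ c ≡ just x → c < width T
  width-bound zero c Tx with R , T[0] , Rx ← entry-just T 0 c Tx rewrite T[0] = nth-just⇒< c R Rx
  width-bound (suc ρ) c Ty with x , Tx , _ ← entry-above ρ c Ty = width-bound ρ c Tx

  col : ℕ → List ℕ
  col k = colOf T (suc k)

  nth-col : ∀ k q → nth q (col k) ≡ entry T q k
  nth-col k = nth-column k T (Linked.map <⇒≤ rows-decreasing)

  col-increasing : ∀ k → AllPairs _<_ (col k)
  col-increasing k = Linked⇒AllPairs <-trans (nth⇒linked (col k) (λ q {x} {y} Cx Cy →
    colsStrict q k x y (trans (sym (nth-col k q)) Cx) (trans (sym (nth-col k (suc q))) Cy)))

  adjacent-columns : ∀ k → AdjacentColumns (col k) (col (suc k))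
  adjacent-columns k = record
    { left-increasing  = col-increasing k
    ; right-increasing = col-increasing (suc k)
    ; lengths          = length-from-nth (col k) (col (suc k)) short long
    ; rows-weak        = λ q {x} {y} Cx Cy → rowsWeak q k x y (trans (sym (nth-col k q)) Cx) (trans (sym (nth-col (suc k) q)) Cy)
    }
    where
      short : ∀ q → nth q (col (suc k)) ≡ nothing → nth (suc q) (col k) ≡ nothing
      short q e rewrite nth-col (suc k) q | nth-col k (suc q) with entry T (suc q) k in Ty
      ... | nothing = refl
      ... | just _ with _ , Tx ← entry-above-right q k Ty with () ← trans (sym e) Tx
      long : ∀ q → nth q (col k) ≡ nothing → nth q (col (suc k)) ≡ nothing
      long q e rewrite nth-col k q | nth-col (suc k) q with entry T q (suc k) in Ty
      ... | nothing = refl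
      ... | just _ with _ , Tx ← entry-left T q k Ty with () ← trans (sym e) Tx

  nth-columns : ∀ k → k < width T → nth k (columns T) ≡ just (col k)
  nth-columns k k<w = trans (nth-map (colOf T) k (oneTo (width T)))
    (cong (Maybe.map (colOf T)) (trans (nth-map suc k (upTo (width T))) (cong (Maybe.map suc) (nth-applyUpTo id (width T) k k<w))))

  nth-columns⁻ : ∀ k {c} → nth k (columns T) ≡ just c → c ≡ col k
  nth-columns⁻ k e with i , e′ , refl ← nth-map-just⁻ (colOf T) k (oneTo (width T)) e
                   with i′ , e″ , refl ← nth-map-just⁻ suc k (upTo (width T)) e′
    = cong (colOf T ∘ suc) (nth-applyUpTo⁻ _ (width T) k e″)

  columns-adjacent : Linked AdjacentColumns (columns T)
  columns-adjacent = nth⇒linked (columns T) λ k e e′ →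
    subst₂ AdjacentColumns (sym (nth-columns⁻ k e)) (sym (nth-columns⁻ (suc k) e′)) (adjacent-columns k)

  countedPair⇔descent : (∃[ r ] ∃[ j ] CountedPair n T r j) ⇔ TableauDescent T
  countedPair⇔descent = mk⇔ to descent⇒countedPair
    where
      to : ∃[ r ] ∃[ j ] CountedPair n T r j → TableauDescent T
      to (zero  , _ , c) with () ← CountedPair.1≤r c
      to (suc ρ , _ , c) = countedPair⇒descent c

  root-pair : ∀ k → suc k < width T →
              (¬ NonOverlapping (hatC T (suc k)) (hatC T (suc (suc k)))) ⇔ Descent (col k) (col (suc k))
  root-pair k k+1<w = rootCols-pair-nonOverlapping columns-adjacent k
                        (nth-columns k (<-trans (n<1+n k) k+1<w)) (nth-columns (suc k) k+1<w)

  rootNotDisjoint⇔descent : RootNotDisjoint T ⇔ TableauDescent T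
  rootNotDisjoint⇔descent = mk⇔ to from
    where
      to : RootNotDisjoint T → TableauDescent T
      to (suc zero , s≤s () , _)
      to (suc (suc k) , _ , k+2≤w , ¬no) with ρ , y , z , Cy , Cz , y<z ← Equivalence.to (root-pair k k+2≤w) ¬no
        = k , ρ , y , z , trans (sym (nth-col k (suc ρ))) Cy , trans (sym (nth-col (suc k) ρ)) Cz , y<z
      from : TableauDescent T → RootNotDisjoint T
      from (k , ρ , y , z , Ty , Tz , y<z) =
        suc (suc k) , s≤s (s≤s z≤n) , k+1<w ,
        Equivalence.from (root-pair k k+1<w) (ρ , y , z , trans (nth-col k (suc ρ)) Ty , trans (nth-col (suc k) ρ) Tz , y<z)
        where k+1<w = width-bound ρ (suc k) Tz

proposition4p8 : (n : ℕ) → 2 ≤ n → (lam : List ℕ) → IsPartition n lam →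
    (T : Tableau) → IsSSYT n (mu n lam) T →
    (0 < nT n T) ⇔ RootNotDisjoint T
proposition4p8 n _ lam (lam-length , lam-decreasing , _) T ssyt =
  ⇔.trans (0<nT⇔countedPair n T) (⇔.trans countedPair⇔descent (⇔.sym rootNotDisjoint⇔descent))
  where open Tableaux lam-length lam-decreasing ssyt
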